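{- Let $\Gamma=(\mathcal{P},\mathcal{L},\mathtt{I})$ be a finite weak generalised $2m$-gon of order $(s,t)$, $m\ge2$, with $s\le t$. Let $C$ be a set of $s+1$ points, let $x$ be an element of $\Gamma$ and let $d\in\{1,\dots,2m-2\}$. If $\mathcal{P}_{\le d-1}(x)\cap C=\emptyset$ and there exists $y\in\Gamma_1(x)$ with $|\mathcal{P}_{\le d}(y)\cap C|\ge2$, then there exists $z\in\Gamma_1(x)$ with $\mathcal{P}_{\le d}(z)\cap C=\emptyset$.
   Context: A weak generalised $n$-gon ($n\ge3$) is a point-line geometry (points, lines, symmetric incidence; elements are points or lines) with no ordinary $k$-gon as subgeometry for $2\le k<n$ and in which any two elements lie in a common ordinary $n$-gon. $\delta$ is distance in the bipartite incidence graph. Order $(s,t)$: each line has exactly $s+1$ points, each point is on exactly $t+1$ lines. $\Gamma_1(x)$ is the set of elements incident with $x$; $\mathcal{P}_{\le i}(x)$ is the set of points at distance at most $i$ from $x$. -}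

module Defs where

open import Data.Nat using (ℕ; zero; suc; _+_; _*_; _∸_; _≤_; _<_)
open import Data.Bool using (Bool; T)
open import Data.Fin using (Fin)
open import Data.List using (List; length; filterᵇ; allFin)
open import Data.Sum using (_⊎_; inj₁; inj₂)
open import Data.Product using (Σ; ∃; _×_; _,_)
open import Data.Empty using (⊥)
open import Relation.Nullary using (¬_)
open import Relation.Binary.PropositionalEquality using (_≡_)

-- A finite point-line geometry with points Fin np, lines Fin nl and
-- incidence given by a Boolean matrix inc (incidence is symmetric by
-- construction: a point p and a line L are incident iff inc p L).

Element : ℕ → ℕ → Set
Element np nl = Fin np ⊎ Fin nl

Inc : ∀ {np nl} → (Fin np → Fin nl → Bool) → Element np nl → Element np nl → Set
Inc inc (inj₁ p) (inj₁ q) = ⊥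
Inc inc (inj₁ p) (inj₂ L) = T (inc p L)
Inc inc (inj₂ L) (inj₁ p) = T (inc p L)
Inc inc (inj₂ L) (inj₂ M) = ⊥

IsOrdinaryGon : ∀ {np nl} → (Fin np → Fin nl → Bool) → ℕ → (ℕ → Element np nl) → Set
IsOrdinaryGon inc k c =
  (∀ i j → i < 2 * k → j < 2 * k → c i ≡ c j → i ≡ j)
  × (∀ i → suc i < 2 * k → Inc inc (c i) (c (suc i)))
  × Inc inc (c (2 * k ∸ 1)) (c 0)

InGon : ∀ {np nl} → ℕ → (ℕ → Element np nl) → Element np nl → Set
InGon k c a = ∃ λ i → i < 2 * k × c i ≡ a

IsWeakGenPolygon : ∀ {np nl} → ℕ → (Fin np → Fin nl → Bool) → Set
IsWeakGenPolygon {np} {nl} n inc =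
  (∀ k → 2 ≤ k → k < n → ∀ (c : ℕ → Element np nl) → ¬ IsOrdinaryGon inc k c)
  × (∀ (a b : Element np nl) → ∃ λ (c : ℕ → Element np nl) →
       IsOrdinaryGon inc n c × InGon n c a × InGon n c b)

HasOrder : ∀ {np nl} → (Fin np → Fin nl → Bool) → ℕ → ℕ → Set
HasOrder {np} {nl} inc s t =
  (∀ (L : Fin nl) → length (filterᵇ (λ p → inc p L) (allFin np)) ≡ suc s)
  × (∀ (p : Fin np) → length (filterᵇ (λ L → inc p L) (allFin nl)) ≡ suc t)

data Walk {np nl} (inc : Fin np → Fin nl → Bool) :
          Element np nl → Element np nl → ℕ → Set where
  here : ∀ {a} → Walk inc a a 0
  step : ∀ {a b c k} → Inc inc a b → Walk inc b c k → Walk inc a c (suc k)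

DistLe : ∀ {np nl} → (Fin np → Fin nl → Bool) → Element np nl → Element np nl → ℕ → Set
DistLe inc a b i = ∃ λ k → k ≤ i × Walk inc a b k

{-# OPTIONS --safe #-}
module Submission where

-- The incidence graph is bipartite, so if δ(x, p) ≥ d then every walk from x to p of length
-- at most d + 1 is a geodesic, and all of them have the same length.  Two distinct neighbours
-- z, z' of x within distance d of p therefore give two geodesics from x to p with different
-- first steps; running along one up to the first element where they meet again and back along
-- the other is an ordinary J-gon with 2 ≤ J ≤ d + 1 < 2m, which a weak generalised 2m-gon does
-- not have.  So each point of C is near at most one neighbour of x.  If every neighbour were
-- near a point of C, we could choose these points different from q (q is near y only, and y
-- can take p instead), giving an injection of the at least s + 1 neighbours of x into the
-- s-element set C ∖ {q}.

open import Defs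
open import Data.Bool using (Bool; true; false; not; T?)
open import Data.Bool.Properties using (not-injective; not-¬)
open import Data.Empty using (⊥-elim)
open import Data.Fin using (Fin)
import Data.Fin as Fin
open import Data.Fin.Properties using (any?)
open import Data.Fin.Subset using (Subset; _∈_; ∣_∣; _-_)
open import Data.Fin.Subset.Properties
  using (_∈?_; x∈p⇒∣p-x∣<∣p∣; x∈p∧x≢y⇒x∈p-y)
open import Data.List using (List; []; _∷_; length; map; filterᵇ; allFin)
open import Data.List.Properties using (length-map)
open import Data.List.Relation.Unary.All as All using (All; []; _∷_)
open import Data.List.Relation.Unary.All.Properties using (all-filter; map⁺)
open import Data.List.Relation.Unary.AllPairs using ([]; _∷_)
open import Data.List.Relation.Unary.Unique.Propositional using (Unique)
import Data.List.Relation.Unary.Unique.Propositional.Properties as Unique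
open import Data.Nat using (ℕ; zero; suc; _+_; _*_; _∸_; _≤_; _<_; z≤n; s≤s; _≤?_)
open import Data.Nat.Properties
open import Data.Product using (∃; _×_; _,_)
open import Data.Sum using (inj₁; inj₂)
open import Data.Sum.Properties using (≡-dec; inj₁-injective; inj₂-injective)
open import Relation.Binary.Definitions using (DecidableEquality; tri<; tri≈; tri>)
open import Relation.Binary.PropositionalEquality
  using (_≡_; _≢_; refl; sym; trans; cong; subst; subst₂; module ≡-Reasoning)
open import Relation.Nullary using (¬_; Dec; yes; no; contradiction)
open import Relation.Nullary.Decidable using (_×-dec_; ¬?; map′; decidable-stable)
open import Relation.Unary using (Decidable)
open import Function using (_∘_; case_of_)

least-witness : ∀ {P : ℕ → Set} → Decidable P → ∀ {n} → P n →
                ∃ λ j → P j × (∀ {i} → i < j → ¬ P i)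
least-witness P? {zero} p = 0 , p , λ ()
least-witness P? {suc n} p with P? 0
... | yes p0 = 0 , p0 , λ ()
... | no ¬p0 with least-witness (λ i → P? (suc i)) p
...   | j , pj , below = suc j , pj , λ { {zero} _ → ¬p0 ; {suc i} (s≤s i<j) → below i<j }

matching⇒length≤∣p∣ : ∀ {A : Set} {n} (R : A → Fin n → Set) →
  (∀ {z z' p} → R z p → R z' p → z ≡ z') →
  ∀ {C : Subset n} {zs : List A} → Unique zs →
  All (λ z → ∃ λ p → p ∈ C × R z p) zs → length zs ≤ ∣ C ∣
matching⇒length≤∣p∣ R injective [] [] = z≤n
matching⇒length≤∣p∣ R injective {C} {z ∷ _} (z∉zs ∷ zs!) ((p , p∈C , zRp) ∷ matched) =
  ≤-trans (s≤s (matching⇒length≤∣p∣ R injective zs!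
                  (All.zipWith avoid (z∉zs , matched))))
          (x∈p⇒∣p-x∣<∣p∣ p∈C)
  where
  avoid : ∀ {z'} → z ≢ z' × (∃ λ p' → p' ∈ C × R z' p') →
          ∃ λ p' → p' ∈ C - p × R z' p'
  avoid (z≢z' , p' , p'∈C , z'Rp') =
    p' , x∈p∧x≢y⇒x∈p-y p'∈C (λ { refl → z≢z' (injective zRp z'Rp') }) , z'Rp'

module Incidence {np nl : ℕ} (inc : Fin np → Fin nl → Bool) where

  _≟ᴱ_ : DecidableEquality (Element np nl)
  _≟ᴱ_ = ≡-dec Fin._≟_ Fin._≟_

  Inc-sym : ∀ {a b} → Inc inc a b → Inc inc b a
  Inc-sym {inj₁ _} {inj₂ _} a~b = a~b
  Inc-sym {inj₂ _} {inj₁ _} a~b = a~b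

  Inc? : ∀ a b → Dec (Inc inc a b)
  Inc? (inj₁ _) (inj₁ _) = no λ ()
  Inc? (inj₁ p) (inj₂ L) = T? (inc p L)
  Inc? (inj₂ L) (inj₁ p) = T? (inc p L)
  Inc? (inj₂ _) (inj₂ _) = no λ ()

  ∃-element? : ∀ {P : Element np nl → Set} → Decidable P → Dec (∃ P)
  ∃-element? P? with any? (λ p → P? (inj₁ p)) | any? (λ L → P? (inj₂ L))
  ... | yes (p , Pp) | _ = yes (inj₁ p , Pp)
  ... | no _ | yes (L , PL) = yes (inj₂ L , PL)
  ... | no ∄p | no ∄L =
    no λ { (inj₁ p , Pp) → ∄p (p , Pp) ; (inj₂ L , PL) → ∄L (L , PL) }

  Walk? : ∀ k a b → Dec (Walk inc a b k)
  Walk? zero a b with a ≟ᴱ b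
  ... | yes refl = yes here
  ... | no a≢b = no λ { here → a≢b refl }
  Walk? (suc k) a b = map′ (λ (c , a~c , w) → step a~c w)
                           (λ { (step a~c w) → _ , a~c , w })
                           (∃-element? (λ c → Inc? a c ×-dec Walk? k c b))

  DistLe? : ∀ a b i → Dec (DistLe inc a b i)
  DistLe? a b i = map′ (λ (k , k<1+i , w) → k , ≤-pred k<1+i , w)
                       (λ (k , k≤i , w) → k , s≤s k≤i , w)
                       (anyUpTo? (λ k → Walk? k a b) (suc i))

  isPoint : Element np nl → Bool
  isPoint (inj₁ _) = true
  isPoint (inj₂ _) = false

  isPoint-Inc : ∀ {a b} → Inc inc a b → isPoint b ≡ not (isPoint a)
  isPoint-Inc {inj₁ _} {inj₂ _} _ = refl
  isPoint-Inc {inj₂ _} {inj₁ _} _ = refl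

  flips : ℕ → Bool → Bool
  flips zero b = b
  flips (suc k) b = flips k (not b)

  flips-injective : ∀ k {b b'} → flips k b ≡ flips k b' → b ≡ b'
  flips-injective zero e = e
  flips-injective (suc k) e = not-injective (flips-injective k e)

  walk-isPoint : ∀ {a b k} → Walk inc a b k → isPoint b ≡ flips k (isPoint a)
  walk-isPoint here = refl
  walk-isPoint {k = suc k} (step a~c w) =
    trans (walk-isPoint w) (cong (flips k) (isPoint-Inc a~c))

  walk-parity : ∀ {a b k} → Walk inc a b k → ¬ Walk inc a b (suc k)
  walk-parity {k = k} w w' =
    not-¬ refl (flips-injective k (trans (sym (walk-isPoint w)) (walk-isPoint w')))

  Chain : (ℕ → Element np nl) → ℕ → Set
  Chain f n = ∀ i → i < n → Inc inc (f i) (f (suc i))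

  chain-walk : ∀ {n} f → Chain f n → ∀ i l → i + l ≤ n → Walk inc (f i) (f (i + l)) l
  chain-walk f ch i zero _ rewrite +-identityʳ i = here
  chain-walk {n} f ch i (suc l) i+1+l≤n =
    step (ch i (≤-trans (s≤s (m≤m+n i l)) 1+i+l≤n))
         (subst (λ j → Walk inc (f (suc i)) (f j) l) (sym (+-suc i l))
                (chain-walk f ch (suc i) l 1+i+l≤n))
    where
    1+i+l≤n : suc i + l ≤ n
    1+i+l≤n = subst (_≤ n) (+-suc i l) i+1+l≤n

  vertex : ∀ {a b k} → Walk inc a b k → ℕ → Element np nl
  vertex {a} _ zero = a
  vertex {a} here (suc _) = a
  vertex (step _ w) (suc i) = vertex w i

  vertex-last : ∀ {a b k} (w : Walk inc a b k) → vertex w k ≡ b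
  vertex-last here = refl
  vertex-last (step _ w) = vertex-last w

  vertex-chain : ∀ {a b k} (w : Walk inc a b k) → Chain (vertex w) k
  vertex-chain (step a~c _) zero _ = a~c
  vertex-chain (step _ w) (suc i) (s≤s i<k) = vertex-chain w i i<k

  _++ʷ_ : ∀ {a b c k l} → Walk inc a b k → Walk inc b c l → Walk inc a c (k + l)
  here ++ʷ w' = w'
  step a~b w ++ʷ w' = step a~b (w ++ʷ w')

  record Geodesic (u v : Element np nl) (D : ℕ) (f : ℕ → Element np nl) : Set where
    field
      start    : f 0 ≡ u
      end      : f D ≡ v
      chain    : Chain f D
      shortest : ∀ {k} → k < D → ¬ Walk inc u v k

  open Geodesic

  walk⇒geodesic : ∀ {u v k} (w : Walk inc u v k) →
                  (∀ {l} → l < k → ¬ Walk inc u v l) → Geodesic u v k (vertex w)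
  walk⇒geodesic w no-shorter = record
    { start = refl ; end = vertex-last w ; chain = vertex-chain w ; shortest = no-shorter }

  shortcut : ∀ {u v D f g i k} → Geodesic u v D g → Geodesic u v D f →
             i < k → k ≤ D → g i ≢ f k
  shortcut {u} {v} {D} {f} {g} {i} {k} γ' γ i<k k≤D gi≡fk =
    shortest γ (subst (i + (D ∸ k) <_) (m+[n∸m]≡n k≤D) (+-monoˡ-< (D ∸ k) i<k))
               (prefix ++ʷ suffix)
    where
    prefix : Walk inc u (f k) i
    prefix = subst₂ (λ a b → Walk inc a b i) (start γ') gi≡fk
                    (chain-walk g (chain γ') 0 i (≤-trans (<⇒≤ i<k) k≤D))
    suffix : Walk inc (f k) v (D ∸ k)
    suffix = subst (λ b → Walk inc (f k) b (D ∸ k))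
                   (trans (cong f (m+[n∸m]≡n k≤D)) (end γ))
                   (chain-walk f (chain γ) k (D ∸ k) (≤-reflexive (m+[n∸m]≡n k≤D)))

  geodesics-meet-in-step : ∀ {u v D f g i k} → Geodesic u v D f → Geodesic u v D g →
                           i ≤ D → k ≤ D → f i ≡ g k → i ≡ k
  geodesics-meet-in-step {i = i} {k} γ γ' i≤D k≤D fi≡gk with <-cmp i k
  ... | tri< i<k _ _ = ⊥-elim (shortcut γ γ' i<k k≤D fi≡gk)
  ... | tri≈ _ i≡k _ = i≡k
  ... | tri> _ _ k<i = ⊥-elim (shortcut γ' γ k<i i≤D (sym fi≡gk))

  closed-chain⇒ordinaryGon : ∀ {J c} → 1 ≤ J → Chain c (2 * J) → c (2 * J) ≡ c 0 →
    (∀ i i' → i < 2 * J → i' < 2 * J → c i ≡ c i' → i ≡ i') → IsOrdinaryGon inc J c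
  closed-chain⇒ordinaryGon {suc J} {c} (s≤s z≤n) ch closed injective =
    injective , (λ i 1+i<2J → ch i (<⇒≤ 1+i<2J)) ,
    subst (Inc inc (c (2 * suc J ∸ 1))) closed (ch (2 * suc J ∸ 1) ≤-refl)

  module FirstMeeting {u v D f g} (γ : Geodesic u v D f) (γ' : Geodesic u v D g)
                      {J} (1≤J : 1 ≤ J) (J≤D : J ≤ D) (meet : f J ≡ g J)
                      (apart : ∀ {i} → 1 ≤ i → i < J → f i ≢ g i) where

    cycle : ℕ → Element np nl
    cycle i with i ≤? J
    ... | yes _ = f i
    ... | no _ = g (2 * J ∸ i)

    2J∸J≡J : 2 * J ∸ J ≡ J
    2J∸J≡J = trans (m+n∸m≡n J (J + 0)) (+-identityʳ J)

    mirror<J : ∀ {i} → J < i → i ≤ 2 * J → 2 * J ∸ i < J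
    mirror<J {i} J<i i≤2J = subst (2 * J ∸ i <_) 2J∸J≡J (∸-monoʳ-< J<i i≤2J)

    cycle-left : ∀ {i} → i ≤ J → cycle i ≡ f i
    cycle-left {i} i≤J with i ≤? J
    ... | yes _ = refl
    ... | no i≰J = ⊥-elim (i≰J i≤J)

    cycle-right : ∀ {i} → J ≤ i → cycle i ≡ g (2 * J ∸ i)
    cycle-right {i} J≤i with i ≤? J
    ... | no _ = refl
    ... | yes i≤J with ≤-antisym i≤J J≤i
    ...   | refl = trans meet (cong g (sym 2J∸J≡J))

    cycle-chain : Chain cycle (2 * J)
    cycle-chain i i<2J with suc i ≤? J
    ... | yes 1+i≤J =
      subst (λ a → Inc inc a (f (suc i))) (sym (cycle-left (<⇒≤ 1+i≤J)))
            (chain γ i (≤-trans 1+i≤J J≤D))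
    ... | no 1+i≰J =
      subst (λ a → Inc inc a (g r))
            (sym (trans (cycle-right J≤i) (cong g (+-∸-assoc 1 i<2J))))
            (Inc-sym {g r} {g (suc r)}
                     (chain γ' r (≤-trans (mirror<J (s≤s J≤i) i<2J) J≤D)))
      where
      J≤i : J ≤ i
      J≤i = ≤-pred (≰⇒> 1+i≰J)
      r : ℕ
      r = 2 * J ∸ suc i

    no-crossing : ∀ {i i'} → i ≤ J → J < i' → i' < 2 * J → f i ≢ g (2 * J ∸ i')
    no-crossing {i} {i'} i≤J J<i' i'<2J fi≡gi* =
      apart (subst (1 ≤_) i*≡i (m<n⇒0<n∸m i'<2J))
            (subst (_< J) i*≡i i*<J)
            (subst (λ k → f i ≡ g k) i*≡i fi≡gi*)
      where
      i*<J : 2 * J ∸ i' < J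
      i*<J = mirror<J J<i' (<⇒≤ i'<2J)
      i*≡i : 2 * J ∸ i' ≡ i
      i*≡i = sym (geodesics-meet-in-step γ γ' (≤-trans i≤J J≤D)
                                              (≤-trans (<⇒≤ i*<J) J≤D) fi≡gi*)

    cycle-injective : ∀ i i' → i < 2 * J → i' < 2 * J → cycle i ≡ cycle i' → i ≡ i'
    cycle-injective i i' i<2J i'<2J e with i ≤? J | i' ≤? J
    ... | yes i≤J | yes i'≤J =
      geodesics-meet-in-step γ γ (≤-trans i≤J J≤D) (≤-trans i'≤J J≤D) e
    ... | yes i≤J | no i'≰J = ⊥-elim (no-crossing i≤J (≰⇒> i'≰J) i'<2J e)
    ... | no i≰J | yes i'≤J = ⊥-elim (no-crossing i'≤J (≰⇒> i≰J) i<2J (sym e))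
    ... | no i≰J | no i'≰J =
      ∸-cancelˡ-≡ (<⇒≤ i<2J) (<⇒≤ i'<2J)
        (geodesics-meet-in-step γ' γ' (mirror≤D i≰J) (mirror≤D i'≰J) e)
      where
      mirror≤D : ∀ {k} → ¬ k ≤ J → 2 * J ∸ k ≤ D
      mirror≤D k≰J =
        ≤-trans (∸-monoʳ-≤ (2 * J) (<⇒≤ (≰⇒> k≰J)))
                (≤-trans (≤-reflexive 2J∸J≡J) J≤D)

    cycle-closed : cycle (2 * J) ≡ cycle 0
    cycle-closed = begin
      cycle (2 * J)     ≡⟨ cycle-right (m≤m+n J _) ⟩
      g (2 * J ∸ 2 * J) ≡⟨ cong g (n∸n≡0 (2 * J)) ⟩
      g 0               ≡⟨ trans (start γ') (sym (start γ)) ⟩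
      f 0               ≡⟨ sym (cycle-left z≤n) ⟩
      cycle 0           ∎
      where open ≡-Reasoning

    ordinaryGon : IsOrdinaryGon inc J cycle
    ordinaryGon = closed-chain⇒ordinaryGon 1≤J cycle-chain cycle-closed cycle-injective

  OrdinaryGonUpTo : ℕ → Set
  OrdinaryGonUpTo n = ∃ λ J → 2 ≤ J × J ≤ n × ∃ (IsOrdinaryGon inc J)

  geodesics⇒ordinaryGon : ∀ {u v n f g} →
                          Geodesic u v (suc n) f → Geodesic u v (suc n) g →
                          f 1 ≢ g 1 → OrdinaryGonUpTo (suc n)
  geodesics⇒ordinaryGon {n = n} {f} {g} γ γ' f1≢g1
    with least-witness (λ i → 1 ≤? i ×-dec f i ≟ᴱ g i)
                       (s≤s z≤n , trans (end γ) (sym (end γ')))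
  ... | J , (1≤J , meet) , before = J , 2≤J , J≤D , cycle , ordinaryGon
    where
    J≤D : J ≤ suc n
    J≤D = ≮⇒≥ (λ D<J → before D<J (s≤s z≤n , trans (end γ) (sym (end γ'))))
    2≤J : 2 ≤ J
    2≤J = ≤∧≢⇒< 1≤J (λ { refl → f1≢g1 meet })
    open FirstMeeting γ γ' 1≤J J≤D meet (λ 1≤i i<J fi≡gi → before i<J (1≤i , fi≡gi))

  far⇒≤length : ∀ {a b d k} → ¬ DistLe inc a b (d ∸ 1) → Walk inc a b k → d ≤ k
  far⇒≤length far w = ≮⇒≥ (λ k<d → far (_ , ∸-monoˡ-≤ 1 k<d , w))

  far-walk-shortest : ∀ {a b d k} → ¬ DistLe inc a b (d ∸ 1) → k ≤ d →
                      Walk inc a b (suc k) → ∀ {l} → l < suc k → ¬ Walk inc a b l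
  far-walk-shortest {a} {b} far k≤d w (s≤s l≤k) w' =
    walk-parity (subst (Walk inc a b) l≡k w') w
    where
    l≡k = ≤-antisym l≤k (≤-trans k≤d (far⇒≤length far w'))

  near-neighbours⇒ordinaryGon : ∀ {x z z' b d} → ¬ DistLe inc x b (d ∸ 1) →
    Inc inc x z → Inc inc x z' → z ≢ z' → DistLe inc z b d → DistLe inc z' b d →
    OrdinaryGonUpTo (suc d)
  near-neighbours⇒ordinaryGon {x} {z} {z'} {b} far x~z x~z' z≢z'
                              (k , k≤d , w) (k' , k'≤d , w')
    with geodesics⇒ordinaryGon (walk⇒geodesic (step x~z w) no-shorter)
                               (walk⇒geodesic (step x~z' (subst (Walk inc z' b) k'≡k w'))
                                              no-shorter)
                               z≢z'
    where
    no-shorter : ∀ {l} → l < suc k → ¬ Walk inc x b l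
    no-shorter = far-walk-shortest far k≤d (step x~z w)
    no-shorter' : ∀ {l} → l < suc k' → ¬ Walk inc x b l
    no-shorter' = far-walk-shortest far k'≤d (step x~z' w')
    k'≡k : k' ≡ k
    k'≡k = ≤-antisym (≮⇒≥ λ k<k' → no-shorter' (s≤s k<k') (step x~z w))
                     (≮⇒≥ λ k'<k → no-shorter (s≤s k'<k) (step x~z' w'))
  ... | J , 2≤J , J≤1+k , gon = J , 2≤J , ≤-trans J≤1+k (s≤s k≤d) , gon

  near-neighbour-unique : ∀ {n x z z' b d} → IsWeakGenPolygon n inc → 2 + d ≤ n →
    ¬ DistLe inc x b (d ∸ 1) → Inc inc x z → Inc inc x z' →
    DistLe inc z b d → DistLe inc z' b d → z ≡ z'
  near-neighbour-unique {z = z} {z'} (no-small-gon , _) 2+d≤n far x~z x~z' z-near z'-near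
    with z ≟ᴱ z'
  ... | yes z≡z' = z≡z'
  ... | no z≢z' with near-neighbours⇒ordinaryGon far x~z x~z' z≢z' z-near z'-near
  ...   | J , 2≤J , J≤1+d , c , gon =
    ⊥-elim (no-small-gon J 2≤J (≤-trans (s≤s J≤1+d) 2+d≤n) c gon)

  Γ₁ : Element np nl → List (Element np nl)
  Γ₁ (inj₁ p) = map inj₂ (filterᵇ (inc p) (allFin nl))
  Γ₁ (inj₂ L) = map inj₁ (filterᵇ (λ p → inc p L) (allFin np))

  Γ₁-unique : ∀ a → Unique (Γ₁ a)
  Γ₁-unique (inj₁ p) =
    Unique.map⁺ inj₂-injective (Unique.filter⁺ (T? ∘ inc p) (Unique.allFin⁺ nl))
  Γ₁-unique (inj₂ L) =
    Unique.map⁺ inj₁-injective (Unique.filter⁺ (λ p → T? (inc p L)) (Unique.allFin⁺ np))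

  Γ₁-incident : ∀ a → All (Inc inc a) (Γ₁ a)
  Γ₁-incident (inj₁ p) = map⁺ (all-filter (T? ∘ inc p) (allFin nl))
  Γ₁-incident (inj₂ L) = map⁺ (all-filter (λ p → T? (inc p L)) (allFin np))

  length-Γ₁ : ∀ {s t} → HasOrder inc s t → s ≤ t → ∀ a → suc s ≤ length (Γ₁ a)
  length-Γ₁ {s} {t} (_ , point-order) s≤t (inj₁ p) = begin
    suc s ≤⟨ s≤s s≤t ⟩
    suc t ≡⟨ sym (point-order p) ⟩
    length lines ≡⟨ sym (length-map inj₂ lines) ⟩
    length (Γ₁ (inj₁ p)) ∎
    where
    open ≤-Reasoning
    lines = filterᵇ (inc p) (allFin nl)
  length-Γ₁ (line-order , _) _ (inj₂ L) =
    ≤-reflexive (sym (trans (length-map inj₁ points) (line-order L)))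
    where
    points = filterᵇ (λ p → inc p L) (allFin np)

lemma2p10 : ∀ {np nl : ℕ} (inc : Fin np → Fin nl → Bool) (m s t : ℕ)
    → 2 ≤ m → IsWeakGenPolygon (2 * m) inc → HasOrder inc s t → s ≤ t
    → (C : Subset np) → ∣ C ∣ ≡ suc s
    → (x : Element np nl) (d : ℕ) → 1 ≤ d → d ≤ 2 * m ∸ 2
    → (∀ (p : Fin np) → p ∈ C → ¬ DistLe inc x (inj₁ p) (d ∸ 1))
    → (∃ λ (y : Element np nl) → Inc inc x y ×
         ∃ λ (p : Fin np) → ∃ λ (q : Fin np) → p ≢ q × p ∈ C × q ∈ C
           × DistLe inc y (inj₁ p) d × DistLe inc y (inj₁ q) d)
    → ∃ λ (z : Element np nl) → Inc inc x z ×
         (∀ (p : Fin np) → p ∈ C → ¬ DistLe inc z (inj₁ p) d)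
lemma2p10 {np} {nl} inc m s t 2≤m polygon order s≤t C ∣C∣≡1+s x d _ d≤2m∸2 far
          (y , x~y , p , q , p≢q , p∈C , q∈C , y-near-p , y-near-q) =
  case ∃-element? (λ z → Inc? x z ×-dec ¬? (near? z)) of λ where
    (yes (z , x~z , ¬near)) → z , x~z , λ p' p'∈C z-near → ¬near (p' , p'∈C , z-near)
    (no ∄far-neighbour) → contradiction
      (matching⇒length≤∣p∣ Near near-unique (Γ₁-unique x)
        (All.map (λ x~z → near-point-avoiding-q x~z
                   (decidable-stable (near? _) λ ¬near → ∄far-neighbour (_ , x~z , ¬near)))
                 (Γ₁-incident x)))
      (<⇒≱ (begin-strict
        ∣ C - q ∣      <⟨ x∈p⇒∣p-x∣<∣p∣ q∈C ⟩
        ∣ C ∣          ≡⟨ ∣C∣≡1+s ⟩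
        suc s          ≤⟨ length-Γ₁ order s≤t x ⟩
        length (Γ₁ x) ∎))
  where
  open Incidence inc
  open ≤-Reasoning

  near? : ∀ z → Dec (∃ λ p' → p' ∈ C × DistLe inc z (inj₁ p') d)
  near? z = any? (λ p' → p' ∈? C ×-dec DistLe? z (inj₁ p') d)

  Near : Element np nl → Fin np → Set
  Near z p' = Inc inc x z × p' ∈ C × DistLe inc z (inj₁ p') d

  near-unique : ∀ {z z' p'} → Near z p' → Near z' p' → z ≡ z'
  near-unique (x~z , p'∈C , z-near) (x~z' , _ , z'-near) =
    near-neighbour-unique polygon 2+d≤2m (far _ p'∈C) x~z x~z' z-near z'-near
    where
    2+d≤2m : 2 + d ≤ 2 * m
    2+d≤2m = ≤-trans (+-monoʳ-≤ 2 d≤2m∸2)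
                     (≤-reflexive (m+[n∸m]≡n (≤-trans 2≤m (m≤m+n m _))))

  near-point-avoiding-q : ∀ {z} → Inc inc x z →
                          (∃ λ p' → p' ∈ C × DistLe inc z (inj₁ p') d) →
                          ∃ λ p' → p' ∈ C - q × Near z p'
  near-point-avoiding-q x~z (p' , p'∈C , z-near) with p' Fin.≟ q
  ... | no p'≢q = p' , x∈p∧x≢y⇒x∈p-y p'∈C p'≢q , x~z , p'∈C , z-near
  ... | yes refl with near-unique (x~z , q∈C , z-near) (x~y , q∈C , y-near-q)
  ...   | refl = p , x∈p∧x≢y⇒x∈p-y p∈C p≢q , x~y , p∈C , y-near-p
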